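{- Let $G$ be an interval colorable graph. Then for all $m,n\in\mathbb{N}$, $G[K_{m,n}]$ is interval colorable, and $$w(G[K_{m,n}])\le (w(G)+1)(m+n)-1\quad\text{and}\quad W(G[K_{m,n}])\ge (W(G)+1)(m+n)-1.$$
   Context: All graphs are finite, undirected, without loops or multiple edges. $K_{m,n}$ is the complete bipartite graph with parts of sizes $m$ and $n$. A proper edge-coloring with consecutive integers $c_1,\ldots,c_t$ is an interval $t$-coloring if all $t$ colors are used and the set of colors on edges incident to each vertex is an interval of integers. A graph is interval colorable if it has an interval $t$-coloring for some positive integer $t$; $w(G)$ and $W(G)$ denote the smallest and largest such $t$. The composition $G[H]$ has vertex set $V(G)\times V(H)$, with $(u_1,v_1)(u_2,v_2)$ an edge iff $u_1u_2\in E(G)$, or $u_1=u_2$ and $v_1v_2\in E(H)$. -}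

module Defs where

open import Data.Nat using (ℕ; _+_; _*_; _≤_; _<ᵇ_)
open import Data.Bool using (Bool; true; false; _∧_; _∨_; _xor_)
open import Data.Fin using (Fin; toℕ; remQuot; _≟_)
open import Data.Product using (_×_; Σ; ∃; proj₁; proj₂)
open import Relation.Nullary.Decidable using (⌊_⌋)
open import Relation.Binary.PropositionalEquality using (_≡_)

record Graph : Set where
  field
    vertices : ℕ
    adj      : Fin vertices → Fin vertices → Bool
open Graph public

IsSimple : Graph → Set
IsSimple G = (∀ u v → adj G u v ≡ adj G v u) × (∀ u → adj G u u ≡ false)

Edge : (G : Graph) → Fin (vertices G) → Fin (vertices G) → Set
Edge G u v = adj G u v ≡ true

-- Complete bipartite graph K_{m,n}: vertices 0..m-1 form one part, m..m+n-1 the other.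
K : ℕ → ℕ → Graph
K m n = record
  { vertices = m + n
  ; adj = λ u v → (toℕ u <ᵇ m) xor (toℕ v <ᵇ m) }

-- Composition (lexicographic product) G[H], vertex (x , y) encoded via remQuot.
compose : Graph → Graph → Graph
compose G H = record
  { vertices = vertices G * vertices H
  ; adj = λ a b →
      let x₁ = proj₁ (remQuot {vertices G} (vertices H) a)
          y₁ = proj₂ (remQuot {vertices G} (vertices H) a)
          x₂ = proj₁ (remQuot {vertices G} (vertices H) b)
          y₂ = proj₂ (remQuot {vertices G} (vertices H) b)
      in adj G x₁ x₂ ∨ (⌊ x₁ ≟ x₂ ⌋ ∧ adj H y₁ y₂) }

-- An interval t-coloring with colors 1,…,t (any t consecutive integers can be shifted
-- to 1,…,t).  c assigns a color to each ordered pair; only values on edges matter.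
record IsIntervalColoring (G : Graph) (t : ℕ)
         (c : Fin (vertices G) → Fin (vertices G) → ℕ) : Set where
  field
    symm     : ∀ u v → Edge G u v → c u v ≡ c v u
    inRange  : ∀ u v → Edge G u v → (1 ≤ c u v) × (c u v ≤ t)
    proper   : ∀ u v w → Edge G u v → Edge G u w → c u v ≡ c u w → v ≡ w
    allUsed  : ∀ k → 1 ≤ k → k ≤ t → Σ (Fin (vertices G)) λ u →
                 Σ (Fin (vertices G)) λ v → Edge G u v × (c u v ≡ k)
    interval : ∀ u v w k → Edge G u v → Edge G u w → c u v ≤ k → k ≤ c u w →
                 Σ (Fin (vertices G)) λ x → Edge G u x × (c u x ≡ k)

HasIntervalColoring : Graph → ℕ → Set
HasIntervalColoring G t =
  Σ (Fin (vertices G) → Fin (vertices G) → ℕ) λ c → IsIntervalColoring G t c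

IntervalColorable : Graph → Set
IntervalColorable G = Σ ℕ λ t → (1 ≤ t) × HasIntervalColoring G t

IsMinIntervalColors : Graph → ℕ → Set
IsMinIntervalColors G a =
  (1 ≤ a) × HasIntervalColoring G a × (∀ t → 1 ≤ t → HasIntervalColoring G t → a ≤ t)

IsMaxIntervalColors : Graph → ℕ → Set
IsMaxIntervalColors G a =
  (1 ≤ a) × HasIntervalColoring G a × (∀ t → 1 ≤ t → HasIntervalColoring G t → t ≤ a)

module Submission where

-- The heart of the proof is a blow-up construction.  Put p = m + n and let c be an
-- interval t-colouring of G.  A vertex y of K_{m,n} has an offset inside its part, and
-- at y every vertex z gets a rank in 0, …, p-1 (the other part first, then y's own).
-- The edge (x,y)(x',z) coming from an edge xx' of G gets colour
--   1 + offset y + (c x x' - 1) p + rank y z,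
-- and the edge (x,y)(x,z) inside a fibre gets 1 + offset y + top x · p + offset z, where
-- top x is the largest colour at x.  At every vertex the colours form an interval, and
-- altogether exactly (t + 1) p - 1 colours are used.

open import Defs
open import Data.Nat
  using (ℕ; zero; suc; _+_; _*_; _∸_; _≤_; _<_; _≤?_; _<?_; z≤n; s≤s; s≤s⁻¹; _⊓_; _<ᵇ_; NonZero; _/_; _%_)
open import Data.Nat.Properties
open import Data.Nat.DivMod using (m%n<n; m≡m%n+[m/n]*n)
open import Data.Nat.Tactic.RingSolver using (solve-∀)
open import Algebra.Properties.CommutativeSemigroup +-commutativeSemigroup using (x∙yz≈y∙xz)
open import Data.Bool using (Bool; true; false; not; _xor_; if_then_else_)
import Data.Bool as Bool
open import Data.Bool.Properties using (not-involutive)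
open import Data.Fin using (Fin; toℕ; fromℕ<; combine; remQuot) renaming (zero to fzero; suc to fsuc)
import Data.Fin as Fin
import Data.Fin.Properties as FinP
open import Data.Product using (_×_; Σ; proj₁; proj₂; _,_)
open import Data.Sum using (_⊎_; inj₁; inj₂)
open import Data.Empty using (⊥; ⊥-elim)
open import Relation.Nullary using (Dec; yes; no)
open import Relation.Nullary.Decidable using (map′; _×-dec_; _→-dec_; _⊎-dec_)
open import Relation.Nullary.Reflects using (ofʸ; ofⁿ)
open import Relation.Binary.PropositionalEquality

EdgeSymmetric : Graph → Set
EdgeSymmetric H = ∀ u v → Edge H u v → Edge H v u

agreeOnEdges : (H : Graph) → EdgeSymmetric H → ∀ {t} (c c' : Fin (vertices H) → Fin (vertices H) → ℕ) →
  (∀ u v → Edge H u v → c u v ≡ c' u v) → IsIntervalColoring H t c → IsIntervalColoring H t c'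
agreeOnEdges H esym {t} c c' eq ic = record
  { symm = λ u v e → trans (sym (eq u v e)) (trans (symm u v e) (eq v u (esym u v e)))
  ; inRange = λ u v e → subst (λ z → (1 ≤ z) × (z ≤ t)) (eq u v e) (inRange u v e)
  ; proper = λ u v w e₁ e₂ q → proper u v w e₁ e₂ (trans (eq u v e₁) (trans q (sym (eq u w e₂))))
  ; allUsed = λ k 1≤k k≤t → let (u , v , e , q) = allUsed k 1≤k k≤t in u , v , e , trans (sym (eq u v e)) q
  ; interval = λ u v w k e₁ e₂ lo hi →
      let (x , e , q) = interval u v w k e₁ e₂ (subst (_≤ k) (sym (eq u v e₁)) lo)
                                                  (subst (k ≤_) (sym (eq u w e₂)) hi)
      in x , e , trans (sym (eq u x e)) q
  }
  where open IsIntervalColoring ic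

edge? : (H : Graph) → ∀ u v → Dec (Edge H u v)
edge? H u v = adj H u v Bool.≟ true

ColourAt : (H : Graph) → (Fin (vertices H) → Fin (vertices H) → ℕ) → Fin (vertices H) → ℕ → Set
ColourAt H c u k = Σ (Fin (vertices H)) λ x → Edge H u x × (c u x ≡ k)

colourAt? : (H : Graph) (c : Fin (vertices H) → Fin (vertices H) → ℕ) → ∀ u k → Dec (ColourAt H c u k)
colourAt? H c u k = FinP.any? λ x → edge? H u x ×-dec (c u x ≟ k)

-- Being an interval colouring is a decidable property of a given colouring:
-- every quantifier ranges over vertices or over a bounded range of colours.
-- The five conditions are restated with the colour quantifiers bounded.
decIsIntervalColoring : (H : Graph) (t : ℕ) (c : Fin (vertices H) → Fin (vertices H) → ℕ) →
  Dec (IsIntervalColoring H t c)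
decIsIntervalColoring H t c =
  map′ toColoring fromColoring (symm? ×-dec range? ×-dec proper? ×-dec allUsed? ×-dec interval?)
  where
  V : Set
  V = Fin (vertices H)
  Symmetric Ranged Proper AllUsed Contiguous : Set
  Symmetric = ∀ u v → Edge H u v → c u v ≡ c v u
  Ranged = ∀ u v → Edge H u v → (1 ≤ c u v) × (c u v ≤ t)
  Proper = ∀ u v w → Edge H u v → Edge H u w → c u v ≡ c u w → v ≡ w
  AllUsed = ∀ {k} → k < suc t → 1 ≤ k → Σ V λ u → ColourAt H c u k
  Contiguous = ∀ u v w {k} → k < suc (c u w) → Edge H u v → Edge H u w → c u v ≤ k → ColourAt H c u k
  symm? : Dec Symmetric
  symm? = FinP.all? λ u → FinP.all? λ v → edge? H u v →-dec (c u v ≟ c v u)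
  range? : Dec Ranged
  range? = FinP.all? λ u → FinP.all? λ v → edge? H u v →-dec ((1 ≤? c u v) ×-dec (c u v ≤? t))
  proper? : Dec Proper
  proper? = FinP.all? λ u → FinP.all? λ v → FinP.all? λ w →
    edge? H u v →-dec edge? H u w →-dec (c u v ≟ c u w) →-dec (v Fin.≟ w)
  allUsed? : Dec AllUsed
  allUsed? = allUpTo? (λ k → (1 ≤? k) →-dec FinP.any? λ u → colourAt? H c u k) (suc t)
  interval? : Dec Contiguous
  interval? = FinP.all? λ u → FinP.all? λ v → FinP.all? λ w →
    allUpTo? (λ k → edge? H u v →-dec edge? H u w →-dec (c u v ≤? k) →-dec colourAt? H c u k) (suc (c u w))
  toColoring : Symmetric × Ranged × Proper × AllUsed × Contiguous → IsIntervalColoring H t c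
  toColoring (s , r , p , a , i) = record
    { symm = s ; inRange = r ; proper = p
    ; allUsed = λ k 1≤k k≤t → a (s≤s k≤t) 1≤k
    ; interval = λ u v w k e₁ e₂ lo hi → i u v w (s≤s hi) e₁ e₂ lo }
  fromColoring : IsIntervalColoring H t c → Symmetric × Ranged × Proper × AllUsed × Contiguous
  fromColoring ic = symm , inRange , proper , (λ {k} k<1+t 1≤k → allUsed k 1≤k (s≤s⁻¹ k<1+t)) ,
                    (λ u v w {k} k< e₁ e₂ lo → interval u v w k e₁ e₂ lo (s≤s⁻¹ k<))
    where open IsIntervalColoring ic

Searchable : (A : Set) → (A → A → Set) → Set₁
Searchable A R = (P : A → Set) → (∀ x y → R x y → P x → P y) → (∀ x → Dec (P x)) → Dec (Σ A P)

finSearchable : ∀ k → Searchable (Fin k) _≡_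
finSearchable k P _ P? = FinP.any? P?

_◂_ : ∀ {B : Set} {a} → B → (Fin a → B) → Fin (suc a) → B
(b ◂ f) fzero = b
(b ◂ f) (fsuc i) = f i

functionsSearchable : ∀ {B : Set} {R : B → B → Set} → Searchable B R → (∀ b → R b b) →
  ∀ a → Searchable (Fin a → B) (λ f g → ∀ i → R (f i) (g i))
functionsSearchable S refl-R zero P resp P? with P? (λ ())
... | yes p = yes ((λ ()) , p)
... | no ¬p = no λ (g , pg) → ¬p (resp g (λ ()) (λ ()) pg)
functionsSearchable {B} {R} S refl-R (suc a) P resp P? =
  map′ (λ (b , f , p) → b ◂ f , p) unfold (S Q respQ Q?)
  where
  Q : B → Set
  Q b = Σ (Fin a → B) λ f → P (b ◂ f)
  respQ : ∀ x y → R x y → Q x → Q y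
  respQ x y r (f , p) = f , resp (x ◂ f) (y ◂ f) (λ { fzero → r ; (fsuc i) → refl-R (f i) }) p
  Q? : ∀ b → Dec (Q b)
  Q? b = functionsSearchable S refl-R a (λ f → P (b ◂ f))
           (λ f g fg p → resp (b ◂ f) (b ◂ g) (λ { fzero → refl-R b ; (fsuc i) → fg i }) p)
           (λ f → P? (b ◂ f))
  unfold : Σ (Fin (suc a) → B) P → Σ B Q
  unfold (g , pg) = g fzero , (λ i → g (fsuc i)) ,
                    resp g _ (λ { fzero → refl-R (g fzero) ; (fsuc i) → refl-R (g (fsuc i)) }) pg

-- Whether a graph has an interval t-colouring is decidable: colours above t are
-- useless, so it suffices to search the finitely many maps V → V → Fin (1 + t).
decHasIntervalColoring : (H : Graph) → EdgeSymmetric H → ∀ t → Dec (HasIntervalColoring H t)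
decHasIntervalColoring H esym t =
  map′ (λ (g , p) → asColoring g , p) clamp
    (functionsSearchable (functionsSearchable (finSearchable (suc t)) (λ _ → refl) N)
                         (λ f i → refl) N P respP (λ g → decIsIntervalColoring H t (asColoring g)))
  where
  N : ℕ
  N = vertices H
  V : Set
  V = Fin N
  asColoring : (V → V → Fin (suc t)) → V → V → ℕ
  asColoring g u v = toℕ (g u v)
  P : (V → V → Fin (suc t)) → Set
  P g = IsIntervalColoring H t (asColoring g)
  respP : ∀ g g' → (∀ u v → g u v ≡ g' u v) → P g → P g'
  respP g g' gg' = agreeOnEdges H esym (asColoring g) (asColoring g') (λ u v _ → cong toℕ (gg' u v))
  clamp : HasIntervalColoring H t → Σ (V → V → Fin (suc t)) P
  clamp (c , ic) = g , agreeOnEdges H esym c (asColoring g) unchanged ic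
    where
    g : V → V → Fin (suc t)
    g u v = fromℕ< (s≤s (m⊓n≤n (c u v) t))
    unchanged : ∀ u v → Edge H u v → c u v ≡ asColoring g u v
    unchanged u v e = trans (sym (m≤n⇒m⊓n≡m (proj₂ (IsIntervalColoring.inRange ic u v e))))
                            (sym (FinP.toℕ-fromℕ< _))

-- An interval t-colouring uses each colour on some edge, and distinct colours on
-- distinct ordered pairs of vertices, so t ≤ |V|².
coloursBound : (H : Graph) → ∀ t → HasIntervalColoring H t → t ≤ vertices H * vertices H
coloursBound H t (c , ic) = ≮⇒≥ collision
  where
  open IsIntervalColoring ic
  V : Set
  V = Fin (vertices H)
  witness : (i : Fin t) → Σ V λ u → Σ V λ v → Edge H u v × (c u v ≡ suc (toℕ i))
  witness i = allUsed (suc (toℕ i)) (s≤s z≤n) (FinP.toℕ<n i)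
  pairOf : Fin t → Fin (vertices H * vertices H)
  pairOf i = combine (proj₁ (witness i)) (proj₁ (proj₂ (witness i)))
  collision : vertices H * vertices H < t → ⊥
  collision N²<t with FinP.pigeonhole N²<t pairOf
  ... | i , j , i<j , samePair with witness i | witness j | samePair
  ...   | u , v , _ , cᵢ | u' , v' , _ , cⱼ | sameComb =
    let (u≡u' , v≡v') = FinP.combine-injective u v u' v' sameComb
    in <-irrefl (suc-injective (trans (sym cᵢ) (trans (cong₂ c u≡u' v≡v') cⱼ))) i<j

module _ {P : ℕ → Set} (P? : ∀ k → Dec (P k)) where

  leastWitness : ∀ a → (Σ ℕ λ k → k ≤ a × P k) →
                 Σ ℕ λ b → P b × b ≤ a × (∀ k → P k → b ≤ k)
  leastWitness zero (.zero , z≤n , pk) = zero , pk , z≤n , λ _ _ → z≤n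
  leastWitness (suc a) (k , k≤ , pk) with anyUpTo? P? (suc a)
  ... | yes (k' , k'<1+a , pk') =
    let (b , pb , b≤a , least) = leastWitness a (k' , s≤s⁻¹ k'<1+a , pk')
    in b , pb , m≤n⇒m≤1+n b≤a , least
  ... | no noneBelow = suc a , subst P k≡1+a pk , ≤-refl , aboveAll
    where
    k≡1+a : k ≡ suc a
    k≡1+a = ≤-antisym k≤ (≮⇒≥ λ k<1+a → noneBelow (k , k<1+a , pk))
    aboveAll : ∀ k' → P k' → suc a ≤ k'
    aboveAll k' pk' = ≮⇒≥ λ k'<1+a → noneBelow (k' , k'<1+a , pk')

  greatestWitness : ∀ B → (Σ ℕ λ k → k ≤ B × P k) →
                    Σ ℕ λ b → P b × b ≤ B × (∀ k → k ≤ B → P k → k ≤ b)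
  greatestWitness B w with P? B
  ... | yes pB = B , pB , ≤-refl , λ _ k≤B _ → k≤B
  greatestWitness zero (.zero , z≤n , p0) | no ¬pB = ⊥-elim (¬pB p0)
  greatestWitness (suc B) (k , k≤ , pk) | no ¬pB =
    let (b , pb , b≤B , greatest) = greatestWitness B (k , notTop k k≤ pk , pk)
    in b , pb , m≤n⇒m≤1+n b≤B , λ k' k'≤ pk' → greatest k' (notTop k' k'≤ pk') pk'
    where
    notTop : ∀ k → k ≤ suc B → P k → k ≤ B
    notTop k k≤ pk with m≤n⇒m<n∨m≡n k≤
    ... | inj₁ lt = s≤s⁻¹ lt
    ... | inj₂ refl = ⊥-elim (¬pB pk)

Realisable : Graph → ℕ → Set
Realisable H k = (1 ≤ k) × HasIntervalColoring H k

realisable? : (H : Graph) → EdgeSymmetric H → ∀ k → Dec (Realisable H k)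
realisable? H esym k = (1 ≤? k) ×-dec decHasIntervalColoring H esym k

minimumExists : (H : Graph) → EdgeSymmetric H → ∀ t → Realisable H t →
  Σ ℕ λ b → IsMinIntervalColors H b × b ≤ t
minimumExists H esym t realisable =
  let (b , (1≤b , colouring) , b≤t , least) = leastWitness (realisable? H esym) t (t , ≤-refl , realisable)
  in b , (1≤b , colouring , λ k 1≤k colk → least k (1≤k , colk)) , b≤t

-- W(H) exists as soon as H is interval colourable (colour counts are bounded by
-- |V|²), and is at least any realisable t.
maximumExists : (H : Graph) → EdgeSymmetric H → ∀ t → Realisable H t →
  Σ ℕ λ b → IsMaxIntervalColors H b × t ≤ b
maximumExists H esym t realisable@(_ , colouring) =
  let (b , (1≤b , colb) , _ , greatest) = greatestWitness (realisable? H esym) (vertices H * vertices H)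
                                            (t , coloursBound H t colouring , realisable)
  in b , (1≤b , colb , λ k 1≤k colk → greatest k (coloursBound H k colk) (1≤k , colk))
       , greatest t (coloursBound H t colouring) realisable

divide : ∀ K p .{{_ : NonZero p}} → Σ ℕ λ q → Σ ℕ λ r → (r < p) × (K ≡ q * p + r)
divide K p = K / p , K % p , m%n<n K p , trans (m≡m%n+[m/n]*n K p) (+-comm (K % p) _)

quotientMonotone : ∀ p a b r r' → a * p + r ≤ b * p + r' → r' < p → a ≤ b
quotientMonotone p a b r r' le r'<p = ≮⇒≥ λ b<a → <⇒≱ (above b<a) le
  where
  above : b < a → b * p + r' < a * p + r
  above b<a = begin-strict
    b * p + r'  <⟨ +-monoʳ-< (b * p) r'<p ⟩
    b * p + p   ≡⟨ +-comm (b * p) p ⟩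
    suc b * p   ≤⟨ *-monoˡ-≤ p b<a ⟩
    a * p       ≤⟨ m≤m+n (a * p) r ⟩
    a * p + r   ∎
    where open ≤-Reasoning

quotientInjective : ∀ p a b r r' → a * p + r ≡ b * p + r' → r < p → r' < p → a ≡ b
quotientInjective p a b r r' eq r<p r'<p =
  ≤-antisym (quotientMonotone p a b r r' (≤-reflexive eq) r'<p)
            (quotientMonotone p b a r' r (≤-reflexive (sym eq)) r<p)

belowBlock : ∀ p a h r → a < h → r < p → a * p + r < h * p
belowBlock p a h r a<h r<p = begin-strict
  a * p + r  <⟨ +-monoʳ-< (a * p) r<p ⟩
  a * p + p  ≡⟨ +-comm (a * p) p ⟩
  suc a * p  ≤⟨ *-monoˡ-≤ p a<h ⟩
  h * p      ∎
  where open ≤-Reasoning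

quotientBound : ∀ p q r h → q * p + r < h * p → q < h
quotientBound p q r h lt = ≰⇒> λ h≤q → <⇒≱ lt (≤-trans (*-monoˡ-≤ p h≤q) (m≤m+n (q * p) r))

addInside : ∀ a b {q q' r r'} → q ≡ q' → a + r ≡ b + r' → a + (q + r) ≡ b + (q' + r')
addInside a b {q} {_} {r} {r'} refl ar≡br' = begin
  a + (q + r)   ≡⟨ x∙yz≈y∙xz a q r ⟩
  q + (a + r)   ≡⟨ cong (q +_) ar≡br' ⟩
  q + (b + r')  ≡⟨ x∙yz≈y∙xz b q r' ⟨
  b + (q + r')  ∎
  where open ≡-Reasoning

-- The largest colour at each vertex of an interval t-coloured graph (0 at isolated
-- vertices), found as the greatest colour k ≤ t that occurs at the vertex.
module TopColour (G : Graph) {t : ℕ} {c : Fin (vertices G) → Fin (vertices G) → ℕ}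
                 (ic : IsIntervalColoring G t c) where
  open IsIntervalColoring ic

  private
    Occurs : Fin (vertices G) → ℕ → Set
    Occurs x k = k ≡ 0 ⊎ ColourAt G c x k

    search : ∀ x → Σ ℕ λ b → Occurs x b × b ≤ t × (∀ k → k ≤ t → Occurs x k → k ≤ b)
    search x = greatestWitness (λ k → (k ≟ 0) ⊎-dec colourAt? G c x k) t (0 , z≤n , inj₁ refl)

  top : Fin (vertices G) → ℕ
  top x = proj₁ (search x)

  top≤t : ∀ x → top x ≤ t
  top≤t x = proj₁ (proj₂ (proj₂ (search x)))

  colour≤top : ∀ x x' → Edge G x x' → c x x' ≤ top x
  colour≤top x x' e =
    proj₂ (proj₂ (proj₂ (search x))) (c x x') (proj₂ (inRange x x' e)) (inj₂ (x' , e , refl))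

  topOccurs : ∀ x x' → Edge G x x' → ColourAt G c x (top x)
  topOccurs x x' e with proj₁ (proj₂ (search x))
  ... | inj₂ occurs = occurs
  ... | inj₁ top≡0 =
    ⊥-elim (<⇒≱ (≤-trans (proj₁ (inRange x x' e)) (colour≤top x x' e)) (≤-reflexive top≡0))

-- A vertex y is described by
-- its part (side y, true for the first part {0,…,m-1}) and its offset inside that
-- part.
module Bipartite (m' n' : ℕ) where
  m n p : ℕ
  m = suc m'
  n = suc n'
  p = m + n

  Y : Set
  Y = Fin p

  side : Y → Bool
  side y = toℕ y <ᵇ m

  size : Bool → ℕ
  size true = m
  size false = n

  start : Bool → ℕ
  start true = 0
  start false = m

  offsetFrom : Bool → ℕ → ℕ
  offsetFrom b i = i ∸ start b

  offset : Y → ℕ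
  offset y = offsetFrom (side y) (toℕ y)

  otherPartFirst : ∀ b → size (not b) + size b ≡ p
  otherPartFirst true = +-comm n m
  otherPartFirst false = refl

  data SideView (i : ℕ) : Bool → Set where
    inFirst  : i < m → SideView i true
    inSecond : m ≤ i → SideView i false

  sideView : ∀ i → SideView i (i <ᵇ m)
  sideView i with i <ᵇ m | <ᵇ-reflects-< i m
  ... | true  | ofʸ i<m = inFirst i<m
  ... | false | ofⁿ i≮m = inSecond (≮⇒≥ i≮m)

  decompose : ∀ i → i < p →
              (start (i <ᵇ m) + offsetFrom (i <ᵇ m) i ≡ i) × (offsetFrom (i <ᵇ m) i < size (i <ᵇ m))
  decompose i i<p with i <ᵇ m | sideView i
  ... | _ | inFirst i<m = refl , i<m
  ... | _ | inSecond m≤i = m+[n∸m]≡n m≤i , +-cancelˡ-< m _ _ (subst (_< p) (sym (m+[n∸m]≡n m≤i)) i<p)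

  recompose : ∀ b d → d < size b →
              (((start b + d) <ᵇ m) ≡ b) × (offsetFrom ((start b + d) <ᵇ m) (start b + d) ≡ d)
  recompose true d d<m with d <ᵇ m | sideView d
  ... | _ | inFirst _ = refl , refl
  ... | _ | inSecond m≤d = ⊥-elim (<⇒≱ d<m m≤d)
  recompose false d _ with (m + d) <ᵇ m | sideView (m + d)
  ... | _ | inFirst m+d<m = ⊥-elim (<⇒≱ m+d<m (m≤m+n m d))
  ... | _ | inSecond _ = refl , m+n∸m≡n m d

  offset<size : ∀ y → offset y < size (side y)
  offset<size y = proj₂ (decompose (toℕ y) (FinP.toℕ<n y))

  offsetInjective : ∀ y z → side y ≡ side z → offset y ≡ offset z → y ≡ z
  offsetInjective y z sameSide sameOffset = FinP.toℕ-injective (begin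
    toℕ y                        ≡⟨ sym (proj₁ (decompose (toℕ y) (FinP.toℕ<n y))) ⟩
    start (side y) + offset y    ≡⟨ cong₂ (λ b d → start b + d) sameSide sameOffset ⟩
    start (side z) + offset z    ≡⟨ proj₁ (decompose (toℕ z) (FinP.toℕ<n z)) ⟩
    toℕ z                        ∎)
    where open ≡-Reasoning

  startInRange : ∀ b d → d < size b → start b + d < p
  startInRange true d d<m = ≤-trans d<m (m≤m+n m n)
  startInRange false d d<n = +-monoʳ-< m d<n

  vertexAt : ∀ b d → d < size b → Σ Y λ z → (side z ≡ b) × (offset z ≡ d)
  vertexAt b d d<size =
    fromℕ< inRange , trans (cong (_<ᵇ m) position) (proj₁ (recompose b d d<size))
                   , trans (cong (λ i → offsetFrom (i <ᵇ m) i) position) (proj₂ (recompose b d d<size))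
    where
    inRange : start b + d < p
    inRange = startInRange b d d<size
    position : toℕ (fromℕ< inRange) ≡ start b + d
    position = FinP.toℕ-fromℕ< inRange

  data Parts (b : Bool) : Bool → Set where
    samePart  : Parts b b
    otherPart : Parts b (not b)

  parts : ∀ b b' → Parts b b'
  parts true true = samePart
  parts true false = otherPart
  parts false true = otherPart
  parts false false = samePart

  rankVia : ∀ {b b'} → Parts b b' → ℕ → ℕ
  rankVia {b} samePart d = size (not b) + d
  rankVia otherPart d = d

  rank : Y → Y → ℕ
  rank y z = rankVia (parts (side y) (side z)) (offset z)

  rank<p : ∀ y z → rank y z < p
  rank<p y z = bound (parts (side y) (side z)) (offset<size z)
    where
    bound : ∀ {b b'} (r : Parts b b') {d} → d < size b' → rankVia r d < p
    bound {b} samePart {d} d<size =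
      subst (size (not b) + d <_) (otherPartFirst b) (+-monoʳ-< (size (not b)) d<size)
    bound {b} otherPart d<size =
      ≤-trans d<size (subst (size (not b) ≤_) (otherPartFirst b) (m≤m+n (size (not b)) (size b)))

  rankSame : ∀ b d → rankVia (parts b b) d ≡ size (not b) + d
  rankSame true d = refl
  rankSame false d = refl

  rankOther : ∀ b d → rankVia (parts b (not b)) d ≡ d
  rankOther true d = refl
  rankOther false d = refl

  rankInjective : ∀ y z z' → rank y z ≡ rank y z' → z ≡ z'
  rankInjective y z z' same =
    let (sameSide , sameOffset) = distinct (parts (side y) (side z)) (parts (side y) (side z'))
                                           (offset<size z) (offset<size z') same
    in offsetInjective z z' sameSide sameOffset
    where
    distinct : ∀ {b b₁ b₂} (r₁ : Parts b b₁) (r₂ : Parts b b₂) {d₁ d₂} →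
               d₁ < size b₁ → d₂ < size b₂ → rankVia r₁ d₁ ≡ rankVia r₂ d₂ → (b₁ ≡ b₂) × (d₁ ≡ d₂)
    distinct {b} samePart samePart _ _ e = refl , +-cancelˡ-≡ (size (not b)) _ _ e
    distinct {b} samePart otherPart {d₁} _ d₂<size e =
      ⊥-elim (<⇒≱ d₂<size (subst (size (not b) ≤_) e (m≤m+n _ d₁)))
    distinct {b} otherPart samePart {_} {d₂} d₁<size _ e =
      ⊥-elim (<⇒≱ d₁<size (subst (size (not b) ≤_) (sym e) (m≤m+n _ d₂)))
    distinct otherPart otherPart _ _ e = refl , e

  rankSurjective : ∀ y r → r < p → Σ Y λ z → rank y z ≡ r
  rankSurjective y r r<p with r <? size (not (side y))
  ... | yes r<other =
    let (z , sz , oz) = vertexAt (not (side y)) r r<other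
    in z , trans (cong₂ (λ b d → rankVia (parts (side y) b) d) sz oz) (rankOther (side y) r)
  ... | no r≮other =
    let (z , sz , oz) = vertexAt (side y) (r ∸ size (not (side y))) own
    in z , trans (cong₂ (λ b d → rankVia (parts (side y) b) d) sz oz)
                 (trans (rankSame (side y) _) (m+[n∸m]≡n (≮⇒≥ r≮other)))
    where
    own : r ∸ size (not (side y)) < size (side y)
    own = +-cancelˡ-< (size (not (side y))) _ _
            (subst (_< size (not (side y)) + size (side y)) (sym (m+[n∸m]≡n (≮⇒≥ r≮other)))
                   (subst (r <_) (sym (otherPartFirst (side y))) r<p))

  -- offset y + rank y z is symmetric in y and z; it will be the position of the
  -- colour of an edge (x,y)(x',z) inside its block.
  rankSymmetric : ∀ y z → offset y + rank y z ≡ offset z + rank z y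
  rankSymmetric y z = symmetric (side y) (side z) (offset y) (offset z)
    where
    swapOuter : ∀ a b c → a + (c + b) ≡ b + (c + a)
    swapOuter = solve-∀
    symmetric : ∀ b b' d d' → d + rankVia (parts b b') d' ≡ d' + rankVia (parts b' b) d
    symmetric true true d d' = swapOuter d d' n
    symmetric true false d d' = +-comm d d'
    symmetric false true d d' = +-comm d d'
    symmetric false false d d' = swapOuter d d' m

  0<size : ∀ b → 0 < size b
  0<size true = s≤s z≤n
  0<size false = s≤s z≤n

  oppositeOffsets : ∀ b {d d'} → d < size b → d' < size (not b) → 2 + (d + d') ≤ p
  oppositeOffsets b {d} {d'} d<size d'<size =
    subst₂ _≤_ (cong suc (+-suc d d')) (trans (+-comm (size b) _) (otherPartFirst b)) (+-mono-≤ d<size d'<size)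

  offsetHeadroom : ∀ y → 2 + offset y ≤ p
  offsetHeadroom y = subst (λ k → 2 + k ≤ p) (+-identityʳ (offset y))
                           (oppositeOffsets (side y) (offset<size y) (0<size (not (side y))))

  splitOffsets : ∀ j → 2 + j ≤ p →
                 Σ Y λ a → Σ Y λ b → (side a ≡ true) × (side b ≡ false) × (offset a + offset b ≡ j)
  splitOffsets j 2+j≤p =
    let (a , sa , oa) = vertexAt true (m' ⊓ j) (s≤s (m⊓n≤m m' j))
        (b , sb , ob) = vertexAt false (j ∸ m') (s≤s rest≤n')
    in a , b , sa , sb , trans (cong₂ _+_ oa ob) (m⊓n+n∸m≡n m' j)
    where
    j≤ : j ≤ m' + n'
    j≤ = s≤s⁻¹ (subst (suc j ≤_) (+-suc m' n') (s≤s⁻¹ 2+j≤p))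
    rest≤n' : j ∸ m' ≤ n'
    rest≤n' = subst (j ∸ m' ≤_) (m+n∸m≡n m' n') (∸-monoˡ-≤ m' j≤)

  xor-true : ∀ b b' → (b xor b') ≡ true → b' ≡ not b
  xor-true true true ()
  xor-true true false _ = refl
  xor-true false true _ = refl
  xor-true false false ()

  xor-not : ∀ b → (b xor not b) ≡ true
  xor-not true = refl
  xor-not false = refl

module Composition (G : Graph) (simple : IsSimple G) (m' n' : ℕ) where
  open Bipartite m' n'

  H : Graph
  H = compose G (K m n)

  V : Set
  V = Fin (vertices G)

  W : Set
  W = Fin (vertices H)

  xOf : W → V
  xOf u = proj₁ (remQuot {vertices G} p u)

  yOf : W → Y
  yOf u = proj₂ (remQuot {vertices G} p u)

  pair : V → Y → W
  pair = combine

  xOf-pair : ∀ x y → xOf (pair x y) ≡ x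
  xOf-pair x y = cong proj₁ (FinP.remQuot-combine x y)

  yOf-pair : ∀ x y → yOf (pair x y) ≡ y
  yOf-pair x y = cong proj₂ (FinP.remQuot-combine x y)

  pairExt : ∀ u v → xOf u ≡ xOf v → yOf u ≡ yOf v → u ≡ v
  pairExt u v sameX sameY = begin
    u                        ≡⟨ sym (FinP.combine-remQuot {vertices G} p u) ⟩
    pair (xOf u) (yOf u)     ≡⟨ cong₂ pair sameX sameY ⟩
    pair (xOf v) (yOf v)     ≡⟨ FinP.combine-remQuot {vertices G} p v ⟩
    v                        ∎
    where open ≡-Reasoning

  noLoop : ∀ u v → xOf u ≡ xOf v → adj G (xOf u) (xOf v) ≡ false
  noLoop u v sameX = trans (cong (adj G (xOf u)) (sym sameX)) (proj₂ simple (xOf u))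

  data EdgeKind (u v : W) : Set where
    hostEdge  : adj G (xOf u) (xOf v) ≡ true → EdgeKind u v
    fibreEdge : xOf u ≡ xOf v → side (yOf v) ≡ not (side (yOf u)) → EdgeKind u v

  edgeKind : ∀ u v → Edge H u v → EdgeKind u v
  edgeKind u v uv with adj G (xOf u) (xOf v) in e
  ... | true = hostEdge e
  ... | false with xOf u Fin.≟ xOf v
  ...   | yes sameX = fibreEdge sameX (xor-true _ _ uv)
  edgeKind u v () | false | no _

  hostEdge→edge : ∀ u v → adj G (xOf u) (xOf v) ≡ true → Edge H u v
  hostEdge→edge u v e rewrite e = refl

  fibreEdge→edge : ∀ u v → xOf u ≡ xOf v → side (yOf v) ≡ not (side (yOf u)) → Edge H u v
  fibreEdge→edge u v sameX opposite rewrite noLoop u v sameX with xOf u Fin.≟ xOf v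
  ... | yes _ = trans (cong (side (yOf u) xor_) opposite) (xor-not (side (yOf u)))
  ... | no differ = ⊥-elim (differ sameX)

  edgeSymmetric : EdgeSymmetric H
  edgeSymmetric u v uv with edgeKind u v uv
  ... | hostEdge e = hostEdge→edge v u (trans (proj₁ simple (xOf v) (xOf u)) e)
  ... | fibreEdge sameX opposite =
    fibreEdge→edge v u (sym sameX) (trans (sym (not-involutive (side (yOf u)))) (cong not (sym opposite)))

  -- An edge (x,y)(x,z)
  -- inside a fibre is placed just above the highest block used at x:
  -- 1 + offset y + top x · p + offset z.
  module Colouring {t : ℕ} {c : V → V → ℕ} (ic : IsIntervalColoring G t c) where
    open IsIntervalColoring ic
    open TopColour G ic

    level : W → W → ℕ
    level u v = if adj G (xOf u) (xOf v)
                then (c (xOf u) (xOf v) ∸ 1) * p + rank (yOf u) (yOf v)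
                else top (xOf u) * p + offset (yOf v)

    colour : W → W → ℕ
    colour u v = suc (offset (yOf u) + level u v)

    levelHost : ∀ u v → adj G (xOf u) (xOf v) ≡ true →
                level u v ≡ (c (xOf u) (xOf v) ∸ 1) * p + rank (yOf u) (yOf v)
    levelHost u v e rewrite e = refl

    levelFibre : ∀ u v → xOf u ≡ xOf v → level u v ≡ top (xOf u) * p + offset (yOf v)
    levelFibre u v sameX rewrite noLoop u v sameX = refl

    hostBelowTop : ∀ u v → adj G (xOf u) (xOf v) ≡ true → level u v < top (xOf u) * p
    hostBelowTop u v e = subst (_< top (xOf u) * p) (sym (levelHost u v e))
      (belowBlock p _ _ _ (lowerBlock (proj₁ (inRange _ _ e)) (colour≤top _ _ e)) (rank<p (yOf u) (yOf v)))
      where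
      lowerBlock : ∀ {s h} → 1 ≤ s → s ≤ h → s ∸ 1 < h
      lowerBlock {suc s} _ s<h = s<h

    fibreAboveTop : ∀ u v → xOf u ≡ xOf v → top (xOf u) * p ≤ level u v
    fibreAboveTop u v sameX = subst (top (xOf u) * p ≤_) (sym (levelFibre u v sameX)) (m≤m+n _ _)

    realiseHost : ∀ u x' → Edge G (xOf u) x' → ∀ r → r < p →
                  Σ W λ v → Edge H u v × (level u v ≡ (c (xOf u) x' ∸ 1) * p + r)
    realiseHost u x' e r r<p =
      let (z , rank≡r) = rankSurjective (yOf u) r r<p
          onEdge = trans (cong (adj G (xOf u)) (xOf-pair x' z)) e
      in pair x' z , hostEdge→edge u (pair x' z) onEdge ,
         trans (levelHost u (pair x' z) onEdge)
               (cong₂ (λ x'' r' → (c (xOf u) x'' ∸ 1) * p + r') (xOf-pair x' z)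
                      (trans (cong (rank (yOf u)) (yOf-pair x' z)) rank≡r))

    realiseFibre : ∀ u d → d < size (not (side (yOf u))) →
                   Σ W λ v → Edge H u v × (level u v ≡ top (xOf u) * p + d)
    realiseFibre u d d<size =
      let (z , sideZ , offsetZ) = vertexAt (not (side (yOf u))) d d<size
          v = pair (xOf u) z
          sameX = sym (xOf-pair (xOf u) z)
      in v , fibreEdge→edge u v sameX (trans (cong side (yOf-pair (xOf u) z)) sideZ) ,
         trans (levelFibre u v sameX) (cong (top (xOf u) * p +_) (trans (cong offset (yOf-pair (xOf u) z)) offsetZ))

    -- offset y + level is symmetric along every edge (by symmetry of c and of
    -- offset + rank), so both endpoints see an edge at the same colour.
    levelSymmetric : ∀ u v → EdgeKind u v → offset (yOf u) + level u v ≡ offset (yOf v) + level v u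
    levelSymmetric u v (hostEdge e) = begin
      offset (yOf u) + level u v
        ≡⟨ cong (offset (yOf u) +_) (levelHost u v e) ⟩
      offset (yOf u) + ((c (xOf u) (xOf v) ∸ 1) * p + rank (yOf u) (yOf v))
        ≡⟨ addInside (offset (yOf u)) (offset (yOf v)) (cong (λ s → (s ∸ 1) * p) (symm _ _ e))
                     (rankSymmetric (yOf u) (yOf v)) ⟩
      offset (yOf v) + ((c (xOf v) (xOf u) ∸ 1) * p + rank (yOf v) (yOf u))
        ≡⟨ cong (offset (yOf v) +_) (levelHost v u (trans (proj₁ simple (xOf v) (xOf u)) e)) ⟨
      offset (yOf v) + level v u
        ∎
      where open ≡-Reasoning
    levelSymmetric u v (fibreEdge sameX _) = begin
      offset (yOf u) + level u v
        ≡⟨ cong (offset (yOf u) +_) (levelFibre u v sameX) ⟩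
      offset (yOf u) + (top (xOf u) * p + offset (yOf v))
        ≡⟨ addInside (offset (yOf u)) (offset (yOf v)) (cong (λ x → top x * p) sameX)
                     (+-comm (offset (yOf u)) (offset (yOf v))) ⟩
      offset (yOf v) + (top (xOf v) * p + offset (yOf u))
        ≡⟨ cong (offset (yOf v) +_) (levelFibre v u (sym sameX)) ⟨
      offset (yOf v) + level v u
        ∎
      where open ≡-Reasoning

    colourBounded : ∀ u v → Edge H u v → colour u v ≤ suc t * p ∸ 1
    colourBounded u v uv = s≤s⁻¹ (bounded (edgeKind u v uv))
      where
      ≤tp : ∀ x → top x * p ≤ t * p
      ≤tp x = *-monoˡ-≤ p (top≤t x)
      bounded : EdgeKind u v → suc (colour u v) ≤ p + t * p
      bounded (hostEdge e) = +-mono-≤ (offsetHeadroom (yOf u))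
                                      (≤-trans (<⇒≤ (hostBelowTop u v e)) (≤tp (xOf u)))
      bounded (fibreEdge sameX opposite) = begin
        suc (colour u v)
          ≡⟨ cong (λ l → 2 + (offset (yOf u) + l)) (levelFibre u v sameX) ⟩
        2 + (offset (yOf u) + (top (xOf u) * p + offset (yOf v)))
          ≡⟨ regroup (offset (yOf u)) (top (xOf u) * p) (offset (yOf v)) ⟩
        2 + (offset (yOf u) + offset (yOf v)) + top (xOf u) * p
          ≤⟨ +-mono-≤ sum≤ (≤tp (xOf u)) ⟩
        p + t * p
          ∎
        where
        open ≤-Reasoning
        regroup : ∀ a b c → 2 + (a + (b + c)) ≡ 2 + (a + c) + b
        regroup = solve-∀
        sum≤ : 2 + (offset (yOf u) + offset (yOf v)) ≤ p
        sum≤ = oppositeOffsets (side (yOf u)) (offset<size (yOf u))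
                 (subst (λ b → offset (yOf v) < size b) opposite (offset<size (yOf v)))

    sameLevel : ∀ u v w → colour u v ≡ colour u w → level u v ≡ level u w
    sameLevel u v w same = +-cancelˡ-≡ (offset (yOf u)) _ _ (suc-injective same)

    -- Distinct edges at a vertex get distinct levels: blocks separate the colours of G,
    -- ranks separate within a block, and the fibre lies above all blocks.
    properLevels : ∀ u v w → EdgeKind u v → EdgeKind u w → level u v ≡ level u w → v ≡ w
    properLevels u v w (hostEdge e₁) (hostEdge e₂) same =
      pairExt v w sameX (rankInjective (yOf u) (yOf v) (yOf w) sameRank)
      where
      blockV blockW : ℕ
      blockV = c (xOf u) (xOf v) ∸ 1
      blockW = c (xOf u) (xOf w) ∸ 1
      blocks : blockV * p + rank (yOf u) (yOf v) ≡ blockW * p + rank (yOf u) (yOf w)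
      blocks = trans (sym (levelHost u v e₁)) (trans same (levelHost u w e₂))
      sameBlock : blockV ≡ blockW
      sameBlock = quotientInjective p _ _ _ _ blocks (rank<p (yOf u) (yOf v)) (rank<p (yOf u) (yOf w))
      predInjective : ∀ {a b} → 1 ≤ a → 1 ≤ b → a ∸ 1 ≡ b ∸ 1 → a ≡ b
      predInjective {suc _} {suc _} _ _ = cong suc
      sameX : xOf v ≡ xOf w
      sameX = proper (xOf u) (xOf v) (xOf w) e₁ e₂
                (predInjective (proj₁ (inRange _ _ e₁)) (proj₁ (inRange _ _ e₂)) sameBlock)
      sameRank : rank (yOf u) (yOf v) ≡ rank (yOf u) (yOf w)
      sameRank = +-cancelˡ-≡ (blockW * p) _ _
                   (trans (cong (λ s → s * p + rank (yOf u) (yOf v)) (sym sameBlock)) blocks)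
    properLevels u v w (hostEdge e₁) (fibreEdge sameX _) same =
      ⊥-elim (<⇒≱ (hostBelowTop u v e₁) (subst (top (xOf u) * p ≤_) (sym same) (fibreAboveTop u w sameX)))
    properLevels u v w (fibreEdge sameX _) (hostEdge e₂) same =
      ⊥-elim (<⇒≱ (hostBelowTop u w e₂) (subst (top (xOf u) * p ≤_) same (fibreAboveTop u v sameX)))
    properLevels u v w (fibreEdge sameX₁ opposite₁) (fibreEdge sameX₂ opposite₂) same =
      pairExt v w (trans (sym sameX₁) sameX₂)
                  (offsetInjective (yOf v) (yOf w) (trans opposite₁ (sym opposite₂)) sameOffset)
      where
      sameOffset : offset (yOf v) ≡ offset (yOf w)
      sameOffset = +-cancelˡ-≡ (top (xOf u) * p) _ _
                     (trans (sym (levelFibre u v sameX₁)) (trans same (levelFibre u w sameX₂)))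

    colourOfLevel : ∀ u v {L} → level u v ≡ L → colour u v ≡ suc (offset (yOf u) + L)
    colourOfLevel u v = cong (λ l → suc (offset (yOf u) + l))

    -- The colours 1, …, t · p: colour q + 1 of G and rank r give colour q p + r + 1
    -- at a vertex (x , y) with offset y = 0.
    usedBelow : ∀ q r → q < t → r < p → Σ W λ u → ColourAt H colour u (suc (q * p + r))
    usedBelow q r q<t r<p =
      let (x₁ , x₂ , e , c≡) = allUsed (suc q) (s≤s z≤n) q<t
          (y₀ , _ , offset≡0) = vertexAt true 0 (s≤s z≤n)
          u = pair x₁ y₀
          (v , uv , levelV) = realiseHost u x₂ (subst (λ x → Edge G x x₂) (sym (xOf-pair x₁ y₀)) e) r r<p
      in u , v , uv , trans (colourOfLevel u v levelV)
           (cong₂ (λ o s → suc (o + ((s ∸ 1) * p + r))) (trans (cong offset (yOf-pair x₁ y₀)) offset≡0)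
                  (trans (cong (λ x → c x x₂) (xOf-pair x₁ y₀)) c≡))

    -- The colours t · p + 1, …, (t + 1) p - 1: fibre edges at a vertex of top colour t.
    usedAbove : 1 ≤ t → ∀ j → 2 + j ≤ p → Σ W λ u → ColourAt H colour u (suc (t * p + j))
    usedAbove 1≤t j 2+j≤p =
      let (x₁ , x₂ , e , c≡t) = allUsed t 1≤t ≤-refl
          top≡t = ≤-antisym (top≤t x₁) (subst (_≤ top x₁) c≡t (colour≤top x₁ x₂ e))
          (a , b , sideA , sideB , sum≡j) = splitOffsets j 2+j≤p
          u = pair x₁ a
          sideU = trans (cong side (yOf-pair x₁ a)) sideA
          bound = subst (λ s → offset b < size s) (trans sideB (cong not (sym sideU))) (offset<size b)
          (v , uv , levelV) = realiseFibre u (offset b) bound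
      in u , v , uv , (begin
        colour u v
          ≡⟨ colourOfLevel u v levelV ⟩
        suc (offset (yOf u) + (top (xOf u) * p + offset b))
          ≡⟨ cong₂ (λ o h → suc (o + (h * p + offset b))) (cong offset (yOf-pair x₁ a))
                   (trans (cong top (xOf-pair x₁ a)) top≡t) ⟩
        suc (offset a + (t * p + offset b))
          ≡⟨ cong suc (x∙yz≈y∙xz (offset a) (t * p) (offset b)) ⟩
        suc (t * p + (offset a + offset b))
          ≡⟨ cong (λ s → suc (t * p + s)) sum≡j ⟩
        suc (t * p + j)
          ∎)
      where open ≡-Reasoning

    allColoursUsed : 1 ≤ t → ∀ k → 1 ≤ k → k ≤ suc t * p ∸ 1 → Σ W λ u → ColourAt H colour u k
    allColoursUsed 1≤t (suc k) _ 1+k≤T with k <? t * p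
    ... | yes k<tp =
      let (q , r , r<p , k≡) = divide k p
          (u , v , uv , colour≡) = usedBelow q r (quotientBound p q r t (subst (_< t * p) k≡ k<tp)) r<p
      in u , v , uv , trans colour≡ (cong suc (sym k≡))
    ... | no k≮tp =
      let (u , v , uv , colour≡) = usedAbove 1≤t (k ∸ t * p) headroom
      in u , v , uv , trans colour≡ (cong suc (m+[n∸m]≡n tp≤k))
      where
      tp≤k : t * p ≤ k
      tp≤k = ≮⇒≥ k≮tp
      headroom : 2 + (k ∸ t * p) ≤ p
      headroom = +-cancelˡ-≤ (t * p) _ _ (subst₂ _≤_ regroup (+-comm p (t * p)) (s≤s 1+k≤T))
        where
        regroup : 2 + k ≡ t * p + (2 + (k ∸ t * p))
        regroup = trans (cong (2 +_) (sym (m+[n∸m]≡n tp≤k))) (x∙yz≈y∙xz 2 (t * p) (k ∸ t * p))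

    -- Below top x · p, a level between two occurring levels occurs by the interval
    -- property of c at x: its block lies between the block of v and the top block.
    levelsBelowTop : ∀ u v K → EdgeKind u v → level u v ≤ K → K < top (xOf u) * p →
                     ColourAt H level u K
    levelsBelowTop u v K (hostEdge e) lo K<top =
      let (q , r , r<p , K≡) = divide K p
          s≤1+q = unshift (proj₁ (inRange _ _ e))
                    (quotientMonotone p _ q _ r (subst₂ _≤_ (levelHost u v e) K≡ lo) r<p)
          (xt , et , ct) = topOccurs (xOf u) (xOf v) e
          q<top = quotientBound p q r (top (xOf u)) (subst (_< top (xOf u) * p) K≡ K<top)
          (x'' , e'' , c'') = interval (xOf u) (xOf v) xt (suc q) e et s≤1+q
                                       (subst (suc q ≤_) (sym ct) q<top)
          (w , uw , levelW) = realiseHost u x'' e'' r r<p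
      in w , uw , trans levelW (trans (cong (λ s → (s ∸ 1) * p + r) c'') (sym K≡))
      where
      unshift : ∀ {s q} → 1 ≤ s → s ∸ 1 ≤ q → s ≤ suc q
      unshift {suc _} _ = s≤s
    levelsBelowTop u v K (fibreEdge sameX _) lo K<top =
      ⊥-elim (<⇒≱ K<top (≤-trans (fibreAboveTop u v sameX) lo))

    -- From top x · p on, levels are fibre levels top x · p + d, and every d below the
    -- offset of an occurring one occurs.
    levelsAboveTop : ∀ u w K → EdgeKind u w → K ≤ level u w → top (xOf u) * p ≤ K →
                     ColourAt H level u K
    levelsAboveTop u w K (hostEdge e) hi top≤K = ⊥-elim (<⇒≱ (hostBelowTop u w e) (≤-trans top≤K hi))
    levelsAboveTop u w K (fibreEdge sameX opposite) hi top≤K =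
      let j≤ = +-cancelˡ-≤ (top (xOf u) * p) _ _
                 (subst₂ _≤_ (sym (m+[n∸m]≡n top≤K)) (levelFibre u w sameX) hi)
          j<size = ≤-<-trans j≤ (subst (λ s → offset (yOf w) < size s) opposite (offset<size (yOf w)))
          (x , ux , levelX) = realiseFibre u (K ∸ top (xOf u) * p) j<size
      in x , ux , trans levelX (m+[n∸m]≡n top≤K)

    levelsContiguous : ∀ u v w K → Edge H u v → Edge H u w → level u v ≤ K → K ≤ level u w →
                       ColourAt H level u K
    levelsContiguous u v w K uv uw lo hi with K <? top (xOf u) * p
    ... | yes K<top = levelsBelowTop u v K (edgeKind u v uv) lo K<top
    ... | no K≮top = levelsAboveTop u w K (edgeKind u w uw) hi (≮⇒≥ K≮top)

    coloursContiguous : ∀ u v w k → Edge H u v → Edge H u w → colour u v ≤ k → k ≤ colour u w →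
                        ColourAt H colour u k
    coloursContiguous u v w k uv uw lo hi =
      let (x , ux , levelX) = levelsContiguous u v w (k ∸ suc d) uv uw
                                (+-cancelˡ-≤ (suc d) _ _ (subst (colour u v ≤_) (sym k≡) lo))
                                (+-cancelˡ-≤ (suc d) _ _ (subst (_≤ colour u w) (sym k≡) hi))
      in x , ux , trans (colourOfLevel u x levelX) k≡
      where
      d : ℕ
      d = offset (yOf u)
      k≡ : suc d + (k ∸ suc d) ≡ k
      k≡ = m+[n∸m]≡n (≤-trans (s≤s (m≤m+n d (level u v))) lo)

    blownUp : 1 ≤ t → IsIntervalColoring H (suc t * p ∸ 1) colour
    blownUp 1≤t = record
      { symm = λ u v uv → cong suc (levelSymmetric u v (edgeKind u v uv))
      ; inRange = λ u v uv → s≤s z≤n , colourBounded u v uv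
      ; proper = λ u v w uv uw same →
          properLevels u v w (edgeKind u v uv) (edgeKind u w uw) (sameLevel u v w same)
      ; allUsed = allColoursUsed 1≤t
      ; interval = coloursContiguous
      }

  blowUp : ∀ t → 1 ≤ t → HasIntervalColoring G t → Realisable H (suc t * p ∸ 1)
  blowUp t 1≤t (c , ic) = positive , Colouring.colour ic , Colouring.blownUp ic 1≤t
    where
    positive : 1 ≤ suc t * p ∸ 1
    positive = ≤-trans (s≤s z≤n) (≤-trans (m≤n+m n m') (m≤m+n (m' + n) (t * p)))

-- G[K_{m,n}] inherits an interval colouring from G; blowing up colourings with w(G)
-- and W(G) colours and taking extremal realisable counts gives the two bounds.
theorem5 : (G : Graph) → IsSimple G → IntervalColorable G →
    (m n : ℕ) → 1 ≤ m → 1 ≤ n →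
    IntervalColorable (compose G (K m n))
    × (∀ a → IsMinIntervalColors G a →
         Σ ℕ λ b → IsMinIntervalColors (compose G (K m n)) b
                   × (b ≤ suc a * (m + n) ∸ 1))
    × (∀ a → IsMaxIntervalColors G a →
         Σ ℕ λ b → IsMaxIntervalColors (compose G (K m n)) b
                   × (suc a * (m + n) ∸ 1 ≤ b))
theorem5 G simple (t , 1≤t , colouring) (suc m') (suc n') _ _ =
  (_ , blowUp t 1≤t colouring) ,
  (λ a (1≤a , colouringₐ , _) → minimumExists H edgeSymmetric _ (blowUp a 1≤a colouringₐ)) ,
  (λ a (1≤a , colouringₐ , _) → maximumExists H edgeSymmetric _ (blowUp a 1≤a colouringₐ))
  where open Composition G simple m' n'
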